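{- Let $m,n\ge 0$ be integers and let $T_{m,n}$ be the square torus grid of dimension $(4m+2)\times(4n+2)$, i.e. the set of cells $\mathbb{Z}/(4m+2)\mathbb{Z}\times\mathbb{Z}/(4n+2)\mathbb{Z}$. Then $T_{m,n}$ cannot be tiled by T-tetrominoes.
   Context: The T-tetromino is the polyomino $\{(0,0),(0,1),(0,2),(1,1)\}\subset\mathbb{Z}^2$ (three unit squares in a row with a fourth square attached to the middle one). A placement of a polyomino $P\subset\mathbb{Z}^2$ on the torus grid is the image of $g(P)+v$ under the reduction map $\mathbb{Z}^2\to\mathbb{Z}/(4m+2)\mathbb{Z}\times\mathbb{Z}/(4n+2)\mathbb{Z}$, where $g$ is a rotation or reflection of the square lattice (an element of the dihedral group of order 8 acting on $\mathbb{Z}^2$) and $v\in\mathbb{Z}^2$, provided that this image consists of $|P|$ distinct cells. A tiling of the torus grid by a polyomino is a collection of placements of that polyomino whose cell sets partition the set of all cells. -}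

module Defs where

open import Data.Nat as ℕ using (ℕ; NonZero)
open import Data.Integer as ℤ using (ℤ; +_; -_; _+_; _%ℕ_)
open import Data.Integer.DivMod using (n%ℕd<d)
open import Data.Fin using (Fin; fromℕ<; zero; suc)
open import Data.Product using (_×_; _,_; Σ; ∃; proj₁; proj₂)
open import Function.Definitions using (Injective)
open import Relation.Binary.PropositionalEquality using (_≡_)

ℤ² : Set
ℤ² = ℤ × ℤ

T-tetromino : Fin 4 → ℤ²
T-tetromino zero                   = (+ 0 , + 0)
T-tetromino (suc zero)             = (+ 0 , + 1)
T-tetromino (suc (suc zero))       = (+ 0 , + 2)
T-tetromino (suc (suc (suc zero))) = (+ 1 , + 1)

-- The dihedral group of order 8 acting on ℤ²: an optional coordinate swap
-- followed by independent sign changes of the two coordinates.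
data Sign : Set where
  pos neg : Sign

applySign : Sign → ℤ → ℤ
applySign pos x = x
applySign neg x = - x

record D4 : Set where
  constructor d4
  field
    swap? : Sign   -- pos: no swap, neg: swap coordinates
    s₁ s₂ : Sign

act : D4 → ℤ² → ℤ²
act (d4 pos a b) (x , y) = (applySign a x , applySign b y)
act (d4 neg a b) (x , y) = (applySign a y , applySign b x)

red : (d : ℕ) .{{_ : NonZero d}} → ℤ → Fin d
red d z = fromℕ< (n%ℕd<d z d)

Cell : ℕ → ℕ → Set
Cell a b = Fin a × Fin b

reduce : (a b : ℕ) .{{_ : NonZero a}} .{{_ : NonZero b}} → ℤ² → Cell a b
reduce a b (x , y) = (red a x , red b y)

PlacementData : Set
PlacementData = D4 × ℤ²

placeCell : (a b : ℕ) .{{_ : NonZero a}} .{{_ : NonZero b}} →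
            PlacementData → Fin 4 → Cell a b
placeCell a b (g , (v₁ , v₂)) i with act g (T-tetromino i)
... | (x , y) = reduce a b (x + v₁ , y + v₂)

IsPlacement : (a b : ℕ) .{{_ : NonZero a}} .{{_ : NonZero b}} →
              PlacementData → Set
IsPlacement a b p = Injective _≡_ _≡_ (placeCell a b p)

InPlacement : (a b : ℕ) .{{_ : NonZero a}} .{{_ : NonZero b}} →
              Cell a b → PlacementData → Set
InPlacement a b c p = ∃ λ (i : Fin 4) → placeCell a b p i ≡ c

record Tiling (a b : ℕ) .{{_ : NonZero a}} .{{_ : NonZero b}} : Set where
  field
    k          : ℕ
    placements : Fin k → PlacementData
    valid      : ∀ j → IsPlacement a b (placements j)
    covers     : ∀ (c : Cell a b) → ∃ λ j → InPlacement a b c (placements j)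
    disjoint   : ∀ (c : Cell a b) (j j' : Fin k) →
                 InPlacement a b c (placements j) →
                 InPlacement a b c (placements j') → j ≡ j'

-- Colour the torus like a chessboard and give the cells of one colour weight 5 and those of the
-- other weight 1. On a torus with even side lengths the colouring is well defined, and every
-- placed T-tetromino covers three cells of one colour and one of the other, so it weighs 16 or 8,
-- a multiple of 8. Every row of even length weighs 3 per cell, so the whole
-- (4m+2) × (4n+2) torus weighs 3 (4m+2) (4n+2) ≡ 4 (mod 8), and no tiling can exist.
module Submission where

open import Defs
open import Data.Nat using (ℕ; suc; _+_; _*_)
open import Relation.Nullary using (¬_)

open import Algebra.Properties.CommutativeSemigroup using (interchange)
open import Data.Integer as ℤ using (ℤ; +_; -[1+_]; _⊖_; _%ℕ_; _/ℕ_)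
import Data.Integer.Properties as ℤ
open import Data.Integer.DivMod using (n%ℕd<d; a≡a%ℕn+[a/ℕn]*n)
open import Data.Fin using (Fin; zero; suc; toℕ)
open import Data.Fin.Properties using (toℕ-fromℕ<)
open import Data.List using (List; []; _∷_; map; _++_; cartesianProduct; allFin; tabulate; length)
open import Data.List.Properties using (map-++; map-∘; map-cong; map-tabulate; length-tabulate)
open import Data.List.Membership.Propositional using (_∈_)
open import Data.List.Membership.Propositional.Properties using (∈-allFin; ∈-map⁺; ∈-cartesianProduct⁺)
open import Data.List.Membership.Propositional.Properties.WithK using (unique∧set⇒bag)
open import Data.List.Relation.Binary.BagAndSetEquality using (∼bag⇒↭)
open import Data.List.Relation.Binary.Permutation.Propositional using (_↭_)
import Data.List.Relation.Binary.Permutation.Propositional.Properties as ↭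
import Data.List.Relation.Unary.Unique.Propositional.Properties as Unique
open import Data.Nat as ℕ using (zero; NonZero; _≤?_)
open import Data.Nat.Divisibility using (_∣_; divides; _∣0; ∣m∣n⇒∣m+n; ∣m+n∣m⇒∣n; m∣m*n; ∣⇒≤)
open import Data.Nat.ListAction using (sum)
open import Data.Nat.ListAction.Properties using (sum-++; sum-↭)
import Data.Nat.Properties as ℕ
open import Data.Nat.Tactic.RingSolver using (solve-∀)
open import Data.Parity.Base as ℙ using (Parity; 0ℙ; 1ℙ)
import Data.Parity.Properties as ℙ
open import Data.Product using (_×_; _,_)
open import Function.Base using (_∘_)
open import Function.Bundles using (mk⇔)
open import Function.Definitions using (Injective)
open import Relation.Binary.PropositionalEquality
open import Relation.Nullary.Decidable using (toWitnessFalse)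

open ≡-Reasoning

double : ℕ → ℕ
double zero    = zero
double (suc n) = suc (suc (double n))

double≡n+n : ∀ n → double n ≡ n + n
double≡n+n zero    = refl
double≡n+n (suc n) = cong suc (trans (cong suc (double≡n+n n)) (sym (ℕ.+-suc n n)))

parityℤ : ℤ → Parity
parityℤ (+ n)    = ℕ.parity n
parityℤ -[1+ n ] = ℕ.parity (suc n)

parity-suc-+-suc : ∀ m n → ℕ.parity (m + n) ≡ ℕ.parity (suc m) ℙ.+ ℕ.parity (suc n)
parity-suc-+-suc m n = begin
  ℕ.parity (suc (suc (m + n)))           ≡⟨ cong (ℕ.parity ∘ suc) (ℕ.+-suc m n) ⟨
  ℕ.parity (suc m + suc n)               ≡⟨ ℙ.+-homo-+ (suc m) (suc n) ⟩
  ℕ.parity (suc m) ℙ.+ ℕ.parity (suc n)  ∎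

parityℤ-⊖ : ∀ m n → parityℤ (m ⊖ n) ≡ ℕ.parity m ℙ.+ ℕ.parity n
parityℤ-⊖ zero    zero    = refl
parityℤ-⊖ zero    (suc n) = refl
parityℤ-⊖ (suc m) zero    = sym (ℙ.+-identityʳ _)
parityℤ-⊖ (suc m) (suc n) = begin
  parityℤ (suc m ⊖ suc n)                ≡⟨ cong parityℤ (ℤ.[1+m]⊖[1+n]≡m⊖n m n) ⟩
  parityℤ (m ⊖ n)                        ≡⟨ parityℤ-⊖ m n ⟩
  ℕ.parity m ℙ.+ ℕ.parity n              ≡⟨ ℙ.+-homo-+ m n ⟨
  ℕ.parity (m + n)                       ≡⟨ parity-suc-+-suc m n ⟩
  ℕ.parity (suc m) ℙ.+ ℕ.parity (suc n)  ∎

parityℤ-+ : ∀ x y → parityℤ (x ℤ.+ y) ≡ parityℤ x ℙ.+ parityℤ y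
parityℤ-+ (+ m)    (+ n)    = ℙ.+-homo-+ m n
parityℤ-+ (+ m)    -[1+ n ] = parityℤ-⊖ m (suc n)
parityℤ-+ -[1+ m ] (+ n)    = trans (parityℤ-⊖ n (suc m)) (ℙ.+-comm (ℕ.parity n) _)
parityℤ-+ -[1+ m ] -[1+ n ] = parity-suc-+-suc m n

parityℤ-neg : ∀ x → parityℤ (ℤ.- x) ≡ parityℤ x
parityℤ-neg (+ zero)  = refl
parityℤ-neg (+ suc n) = refl
parityℤ-neg -[1+ n ]  = refl

parityℤ-applySign : ∀ s x → parityℤ (applySign s x) ≡ parityℤ x
parityℤ-applySign pos x = refl
parityℤ-applySign neg x = parityℤ-neg x

parityℤ-%ℕ-double : ∀ z c .{{_ : NonZero (double c)}} → ℕ.parity (z %ℕ double c) ≡ parityℤ z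
parityℤ-%ℕ-double z c = begin
  ℕ.parity r                                    ≡⟨ ℙ.+-identityʳ _ ⟨
  ℕ.parity r ℙ.+ 0ℙ                            ≡⟨ cong (ℕ.parity r ℙ.+_) (ℙ.p+p≡0ℙ (parityℤ qc)) ⟨
  ℕ.parity r ℙ.+ (parityℤ qc ℙ.+ parityℤ qc)   ≡⟨ cong (ℕ.parity r ℙ.+_) (parityℤ-+ qc qc) ⟨
  ℕ.parity r ℙ.+ parityℤ (qc ℤ.+ qc)           ≡⟨ cong (λ w → ℕ.parity r ℙ.+ parityℤ w) q*[c+c] ⟨
  ℕ.parity r ℙ.+ parityℤ (q ℤ.* + double c)    ≡⟨ parityℤ-+ (+ r) (q ℤ.* + double c) ⟨
  parityℤ (+ r ℤ.+ q ℤ.* + double c)           ≡⟨ cong parityℤ (a≡a%ℕn+[a/ℕn]*n z (double c)) ⟨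
  parityℤ z                                    ∎
  where
  r = z %ℕ double c
  q = z /ℕ double c
  qc = q ℤ.* + c
  q*[c+c] : q ℤ.* + double c ≡ qc ℤ.+ qc
  q*[c+c] = trans (cong (λ d → q ℤ.* d) (trans (cong +_ (double≡n+n c)) (ℤ.pos-+ c c)))
                  (ℤ.*-distribˡ-+ q (+ c) (+ c))

colour : ℤ² → Parity
colour (x , y) = parityℤ y ℙ.+ parityℤ x

colour-act : ∀ g p → colour (act g p) ≡ colour p
colour-act (d4 pos s t) (x , y) = cong₂ ℙ._+_ (parityℤ-applySign t y) (parityℤ-applySign s x)
colour-act (d4 neg s t) (x , y) =
  trans (cong₂ ℙ._+_ (parityℤ-applySign t x) (parityℤ-applySign s y)) (ℙ.+-comm (parityℤ x) _)

translate : ℤ² → ℤ² → ℤ²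
translate (x , y) (v₁ , v₂) = (x ℤ.+ v₁ , y ℤ.+ v₂)

colour-translate : ∀ p v → colour (translate p v) ≡ colour p ℙ.+ colour v
colour-translate (x , y) (v₁ , v₂) =
  trans (cong₂ ℙ._+_ (parityℤ-+ y v₂) (parityℤ-+ x v₁))
        (interchange ℙ.+-commutativeSemigroup (parityℤ y) (parityℤ v₂) (parityℤ x) (parityℤ v₁))

placeCell-translate : ∀ a b .{{_ : NonZero a}} .{{_ : NonZero b}} g v i →
                      placeCell a b (g , v) i ≡ reduce a b (translate (act g (T-tetromino i)) v)
placeCell-translate a b g (v₁ , v₂) i with act g (T-tetromino i)
... | (x , y) = refl

-- The row index y comes first so that toℕ (suc y) + s reduces to suc (toℕ y + s).
cellColour : ∀ {a b} → Cell a b → Parity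
cellColour (x , y) = ℕ.parity (toℕ y + toℕ x)

cellColour-reduce : ∀ ca cb .{{_ : NonZero (double ca)}} .{{_ : NonZero (double cb)}} p →
                    cellColour (reduce (double ca) (double cb) p) ≡ colour p
cellColour-reduce ca cb (x , y) = begin
  ℕ.parity (toℕ (red (double cb) y) + toℕ (red (double ca) x))
    ≡⟨ ℙ.+-homo-+ (toℕ (red (double cb) y)) _ ⟩
  ℕ.parity (toℕ (red (double cb) y)) ℙ.+ ℕ.parity (toℕ (red (double ca) x))
    ≡⟨ cong₂ (λ u w → ℕ.parity u ℙ.+ ℕ.parity w) (toℕ-fromℕ< (n%ℕd<d y _)) (toℕ-fromℕ< (n%ℕd<d x _)) ⟩
  ℕ.parity (y %ℕ double cb) ℙ.+ ℕ.parity (x %ℕ double ca)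
    ≡⟨ cong₂ ℙ._+_ (parityℤ-%ℕ-double y cb) (parityℤ-%ℕ-double x ca) ⟩
  parityℤ y ℙ.+ parityℤ x ∎

weight : Parity → ℕ
weight 0ℙ = 5
weight 1ℙ = 1

weight-adjacent : ∀ s → weight (ℕ.parity s) + weight (ℕ.parity (suc s)) ≡ 6
weight-adjacent zero          = refl
weight-adjacent (suc zero)    = refl
weight-adjacent (suc (suc s)) = weight-adjacent s

weight-alternating : ∀ c s → sum (tabulate {n = double c} (λ y → weight (ℕ.parity (toℕ y + s)))) ≡ c * 6
weight-alternating zero    s = refl
weight-alternating (suc c) s = begin
  weight (ℕ.parity s) + (weight (ℕ.parity (suc s)) + rest) ≡⟨ ℕ.+-assoc (weight (ℕ.parity s)) _ rest ⟨
  weight (ℕ.parity s) + weight (ℕ.parity (suc s)) + rest   ≡⟨ cong₂ _+_ (weight-adjacent s) (weight-alternating c s) ⟩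
  6 + c * 6                                                ∎
  where rest = sum (tabulate {n = double c} (λ y → weight (ℕ.parity (toℕ y + s))))

tetromino-weight : ∀ c → 8 ∣ sum (map (λ i → weight (colour (T-tetromino i) ℙ.+ c)) (allFin 4))
tetromino-weight 0ℙ = divides 2 refl
tetromino-weight 1ℙ = divides 1 refl

sum-map-cartesianProduct : ∀ {A B : Set} (f : A × B → ℕ) xs ys →
  sum (map f (cartesianProduct xs ys)) ≡ sum (map (λ x → sum (map (λ y → f (x , y)) ys)) xs)
sum-map-cartesianProduct f []       ys = refl
sum-map-cartesianProduct f (x ∷ xs) ys = begin
  sum (map f (map (x ,_) ys ++ cartesianProduct xs ys))
    ≡⟨ cong sum (map-++ f (map (x ,_) ys) _) ⟩
  sum (map f (map (x ,_) ys) ++ map f (cartesianProduct xs ys))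
    ≡⟨ sum-++ (map f (map (x ,_) ys)) _ ⟩
  sum (map f (map (x ,_) ys)) + sum (map f (cartesianProduct xs ys))
    ≡⟨ cong₂ _+_ (cong sum (sym (map-∘ ys))) (sum-map-cartesianProduct f xs ys) ⟩
  sum (map (λ y → f (x , y)) ys) + sum (map (λ x → sum (map (λ y → f (x , y)) ys)) xs) ∎

sum-map-const : ∀ {A : Set} {f : A → ℕ} k xs → (∀ x → f x ≡ k) → sum (map f xs) ≡ length xs * k
sum-map-const k []       f≡k = refl
sum-map-const k (x ∷ xs) f≡k = cong₂ _+_ (f≡k x) (sum-map-const k xs f≡k)

∣-sum-map : ∀ {A : Set} {d} (f : A → ℕ) xs → (∀ x → d ∣ f x) → d ∣ sum (map f xs)
∣-sum-map f []       d∣f = _ ∣0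
∣-sum-map f (x ∷ xs) d∣f = ∣m∣n⇒∣m+n (d∣f x) (∣-sum-map f xs d∣f)

allCells : ∀ a b → List (Cell a b)
allCells a b = cartesianProduct (allFin a) (allFin b)

module _ {a b : ℕ} .{{_ : NonZero a}} .{{_ : NonZero b}} (t : Tiling a b) where
  open Tiling t

  tileCell : Fin k × Fin 4 → Cell a b
  tileCell (j , i) = placeCell a b (placements j) i

  tileCell-injective : Injective _≡_ _≡_ tileCell
  tileCell-injective {j , i} {j′ , i′} eq with disjoint (tileCell (j , i)) j j′ (i , refl) (i′ , sym eq)
  ... | refl = cong (j ,_) (valid j eq)

  tileCells-↭-allCells : map tileCell (cartesianProduct (allFin k) (allFin 4)) ↭ allCells a b
  tileCells-↭-allCells = ∼bag⇒↭ (unique∧set⇒bag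
    (Unique.map⁺ tileCell-injective (Unique.cartesianProduct⁺ (Unique.allFin⁺ k) (Unique.allFin⁺ 4)))
    (Unique.cartesianProduct⁺ (Unique.allFin⁺ a) (Unique.allFin⁺ b))
    (λ {c} → mk⇔ (λ _ → ∈-allCells c) (λ _ → ∈-tileCells c)))
    where
    ∈-allCells : ∀ c → c ∈ allCells a b
    ∈-allCells (x , y) = ∈-cartesianProduct⁺ (∈-allFin x) (∈-allFin y)

    ∈-tileCells : ∀ c → c ∈ map tileCell (cartesianProduct (allFin k) (allFin 4))
    ∈-tileCells c with covers c
    ... | (j , (i , refl)) = ∈-map⁺ tileCell (∈-cartesianProduct⁺ (∈-allFin j) (∈-allFin i))

module _ (ca cb : ℕ) .{{_ : NonZero (double ca)}} .{{_ : NonZero (double cb)}} where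

  cellWeight : Cell (double ca) (double cb) → ℕ
  cellWeight = weight ∘ cellColour

  placement-weight : ∀ p → 8 ∣ sum (map (cellWeight ∘ placeCell (double ca) (double cb) p) (allFin 4))
  placement-weight (g , v) = subst (8 ∣_) (cong sum (map-cong cell-weight (allFin 4))) (tetromino-weight (colour v))
    where
    cell-weight : ∀ i → weight (colour (T-tetromino i) ℙ.+ colour v)
                      ≡ cellWeight (placeCell (double ca) (double cb) (g , v) i)
    cell-weight i = cong weight (sym (begin
      cellColour (placeCell (double ca) (double cb) (g , v) i)
        ≡⟨ cong cellColour (placeCell-translate (double ca) (double cb) g v i) ⟩
      cellColour (reduce (double ca) (double cb) (translate (act g (T-tetromino i)) v))
        ≡⟨ cellColour-reduce ca cb (translate (act g (T-tetromino i)) v) ⟩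
      colour (translate (act g (T-tetromino i)) v)
        ≡⟨ colour-translate (act g (T-tetromino i)) v ⟩
      colour (act g (T-tetromino i)) ℙ.+ colour v
        ≡⟨ cong (ℙ._+ colour v) (colour-act g (T-tetromino i)) ⟩
      colour (T-tetromino i) ℙ.+ colour v ∎))

  torus-weight : sum (map cellWeight (allCells (double ca) (double cb))) ≡ double ca * (cb * 6)
  torus-weight = begin
    sum (map cellWeight (allCells (double ca) (double cb)))
      ≡⟨ sum-map-cartesianProduct cellWeight (allFin (double ca)) (allFin (double cb)) ⟩
    sum (map (λ x → sum (map (λ y → cellWeight (x , y)) (allFin (double cb)))) (allFin (double ca)))
      ≡⟨ sum-map-const (cb * 6) (allFin (double ca)) row-weight ⟩
    length (allFin (double ca)) * (cb * 6)
      ≡⟨ cong (_* (cb * 6)) (length-tabulate {n = double ca} (λ x → x)) ⟩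
    double ca * (cb * 6) ∎
    where
    row-weight : ∀ x → sum (map (λ y → cellWeight (x , y)) (allFin (double cb))) ≡ cb * 6
    row-weight x = trans (cong sum (map-tabulate (λ y → y) (λ y → cellWeight (x , y))))
                         (weight-alternating cb (toℕ x))

  tiling-weight-divisible : Tiling (double ca) (double cb) → 8 ∣ double ca * (cb * 6)
  tiling-weight-divisible t = subst (8 ∣_) tiles≡torus
    (∣-sum-map _ (allFin k) (λ j → placement-weight (placements j)))
    where
    open Tiling t
    tiles≡torus : sum (map (λ j → sum (map (λ i → cellWeight (tileCell t (j , i))) (allFin 4))) (allFin k))
                ≡ double ca * (cb * 6)
    tiles≡torus = begin
      sum (map (λ j → sum (map (λ i → cellWeight (tileCell t (j , i))) (allFin 4))) (allFin k))
        ≡⟨ sum-map-cartesianProduct (cellWeight ∘ tileCell t) (allFin k) (allFin 4) ⟨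
      sum (map (cellWeight ∘ tileCell t) (cartesianProduct (allFin k) (allFin 4)))
        ≡⟨ cong sum (map-∘ (cartesianProduct (allFin k) (allFin 4))) ⟩
      sum (map cellWeight (map (tileCell t) (cartesianProduct (allFin k) (allFin 4))))
        ≡⟨ sum-↭ (↭.map⁺ cellWeight (tileCells-↭-allCells t)) ⟩
      sum (map cellWeight (allCells (double ca) (double cb)))
        ≡⟨ torus-weight ⟩
      double ca * (cb * 6) ∎

tiling-weight-divisible-≡ : ∀ {a b} ca cb .{{_ : NonZero a}} .{{_ : NonZero b}} →
                           a ≡ double ca → b ≡ double cb → Tiling a b → 8 ∣ a * (cb * 6)
tiling-weight-divisible-≡ ca cb refl refl = tiling-weight-divisible ca cb

2+4m≡double[1+2m] : ∀ m → 2 + 4 * m ≡ double (suc (2 * m))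
2+4m≡double[1+2m] m = trans (2+4m≡[1+2m]+[1+2m] m) (sym (double≡n+n (suc (2 * m))))
  where
  2+4m≡[1+2m]+[1+2m] : ∀ m → 2 + 4 * m ≡ suc (2 * m) + suc (2 * m)
  2+4m≡[1+2m]+[1+2m] = solve-∀

torus-weight≡4-mod-8 : ∀ m n → (2 + 4 * m) * (suc (2 * n) * 6) ≡ 8 * (1 + 3 * m + 3 * n + 6 * m * n) + 4
torus-weight≡4-mod-8 = solve-∀

8∤4 : ¬ 8 ∣ 4
8∤4 8∣4 = toWitnessFalse {a? = 8 ≤? 4} _ (∣⇒≤ 8∣4)

theorem3p2 : (m n : ℕ) → ¬ Tiling (2 + 4 * m) (2 + 4 * n)
theorem3p2 m n t = 8∤4 (∣m+n∣m⇒∣n 8∣8k+4 (m∣m*n (1 + 3 * m + 3 * n + 6 * m * n)))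
  where
  8∣weight : 8 ∣ (2 + 4 * m) * (suc (2 * n) * 6)
  8∣weight = tiling-weight-divisible-≡ (suc (2 * m)) (suc (2 * n))
               (2+4m≡double[1+2m] m) (2+4m≡double[1+2m] n) t

  8∣8k+4 : 8 ∣ 8 * (1 + 3 * m + 3 * n + 6 * m * n) + 4
  8∣8k+4 = subst (8 ∣_) (torus-weight≡4-mod-8 m n) 8∣weight
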